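{- For every integer $n\geq 9$, \[\left\lceil\log_3 n\right\rceil+2\le \operatorname{aw}([n],3) \le \left\lceil\log_2 n \right\rceil +1 .\] Moreover, $\operatorname{aw}([n],3)=\left\lceil\log_3n\right\rceil+2$ for $n\in\{3,4,5,6,7\}$ and $\operatorname{aw}([8],3)=5$.
   Context: $[n]=\{1,\dots,n\}$. For a finite nonempty subset $S$ of the integers and $k\ge 2$, a $k$-term arithmetic progression ($k$-AP) in $S$ is a set of $k$ distinct elements of $S$ of the form $a,a+d,\dots,a+(k-1)d$ with $d\ge 1$. An $r$-coloring of $S$ is a function $c:S\to\{1,\dots,r\}$; it is exact if $c$ is surjective. A $k$-AP is rainbow under $c$ if its $k$ elements receive $k$ distinct colors. The anti-van der Waerden number $\operatorname{aw}(S,k)$ is the smallest $r$ such that every exact $r$-coloring of $S$ contains a rainbow $k$-AP; by convention $\operatorname{aw}(S,k)=|S|+1$ when $|S|<k$. -}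

module Defs where

open import Data.Nat using (ℕ; _+_; _*_; _^_; _≤_; _<_)
open import Data.Fin using (Fin; toℕ)
open import Data.Product using (Σ; ∃; _×_)
open import Relation.Binary.PropositionalEquality using (_≡_; _≢_)
open import Relation.Nullary using (¬_)

-- [n] = {1,…,n} is represented by Fin n via i ↦ toℕ i + 1 (a translation,
-- which preserves arithmetic progressions). Colors {1,…,r} are Fin r.

Exact : {n r : ℕ} → (Fin n → Fin r) → Set
Exact {n} {r} c = ∀ (j : Fin r) → ∃ λ (i : Fin n) → c i ≡ j

HasRainbow3AP : {n r : ℕ} → (Fin n → Fin r) → Set
HasRainbow3AP {n} c =
  ∃ λ (x : Fin n) → ∃ λ (y : Fin n) → ∃ λ (z : Fin n) → ∃ λ (d : ℕ) →
    (1 ≤ d) × (toℕ y ≡ toℕ x + d) × (toℕ z ≡ toℕ x + 2 * d) ×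
    (c x ≢ c y) × (c y ≢ c z) × (c x ≢ c z)

Forces3 : ℕ → ℕ → Set
Forces3 n r = (c : Fin n → Fin r) → Exact c → HasRainbow3AP c

-- IsAw3 n r : r = aw([n],3), i.e. r is the smallest positive number of colors
-- such that every exact r-coloring of [n] has a rainbow 3-AP.
-- (Used only for n ≥ 3, so the convention for |S| < k is not needed.)
IsAw3 : ℕ → ℕ → Set
IsAw3 n r = (1 ≤ r) × Forces3 n r × (∀ r' → 1 ≤ r' → r' < r → ¬ Forces3 n r')

CeilLog : ℕ → ℕ → ℕ → Set
CeilLog b n m = (n ≤ b ^ m) × (∀ m' → m' < m → b ^ m' < n)

module Submission where

-- Bounds for aw([n],3).  Colourings are maps f : ℕ → ℕ read on [0,n), a
-- translate of [n] with the same 3-APs.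
--
-- In a rainbow-free colouring, a u-point and a v-point (u ≢ v)
-- at even distance have a midpoint coloured u or v; halving the gap gives two
-- such points at odd distance (oddPair), so at most one colour misses a parity
-- class.  Restricting to the odd or even points therefore loses at most one
-- colour (Restriction), and induction gives 2^j ≤ n for j + 1 colours
-- (weakBound), and 2^j < n when n ≥ 9 (strictBound, with n = 16 done by hand).
--
-- The 3-adic valuation truncated at R is rainbow-free and uses
-- all colours 0,…,R on [0,n) once 3^j < n for j < R (ν); [8] has an explicit
-- 4-colouring.  forcing/avoiding turn both into statements about Forces3.

open import Defs
open import Data.Nat using (ℕ; _+_; _≤_)
open import Data.Product using (_×_)
open import Data.Sum using (_⊎_)
open import Relation.Binary.PropositionalEquality using (_≡_)

open import Function using (_∘_)
open import Data.Nat
  using (zero; suc; _*_; _^_; _∸_; _<_; _≟_; _≤?_; _<?_; z≤n; s≤s; ⌊_/2⌋; ⌈_/2⌉)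
open import Data.Nat.Properties
open import Data.Nat.Divisibility using (_∣_; _∣?_; divides; ∣m+n∣m⇒∣n; ∣m∣n⇒∣m+n; n∣m*n; ∣1⇒≡1)
open import Data.Nat.Induction using (<-wellFounded)
open import Data.Nat.Tactic.RingSolver using (solve-∀)
open import Induction.WellFounded using (Acc; acc)
open import Data.Fin using (Fin; zero; suc; toℕ; fromℕ<; punchIn; inject≤)
import Data.Fin.Properties as FinP
open import Data.List using (upTo)
open import Data.List.Relation.Unary.All using (All; []; _∷_; all?) renaming (lookup to lookupAll)
open import Data.List.Membership.Propositional.Properties using (∈-upTo⁺)
open import Data.Product using (Σ; ∃; ∃₂; _,_; proj₁; proj₂)
open import Data.Sum using (inj₁; inj₂; [_,_]′)
open import Data.Empty using (⊥; ⊥-elim)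
open import Data.Unit using (tt)
open import Relation.Nullary using (¬_; Dec; yes; no; contradiction)
open import Relation.Nullary.Decidable
  using (True; False; toWitness; toWitnessFalse; decidable-stable; _⊎-dec_; _×-dec_; ¬?)
open import Relation.Binary.Definitions using (tri<; tri≈; tri>)
open import Relation.Binary.PropositionalEquality
  using (_≢_; refl; sym; trans; cong; subst; subst₂; module ≡-Reasoning)

lit : ∀ {m n} {_ : True (m ≤? n)} → m ≤ n
lit {_} {_} {m≤n} = toWitness m≤n

nlit : ∀ {m n} {_ : False (m ≤? n)} → ¬ m ≤ n
nlit {_} {_} {m≰n} = toWitnessFalse m≰n

NotRainbow : ℕ → ℕ → ℕ → Set
NotRainbow c₁ c₂ c₃ = c₁ ≡ c₂ ⊎ c₂ ≡ c₃ ⊎ c₁ ≡ c₃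

notRainbow? : ∀ c₁ c₂ c₃ → Dec (NotRainbow c₁ c₂ c₃)
notRainbow? c₁ c₂ c₃ = (c₁ ≟ c₂) ⊎-dec ((c₂ ≟ c₃) ⊎-dec (c₁ ≟ c₃))

NotRainbow-cong : ∀ {c₁ c₂ c₃ e₁ e₂ e₃} → c₁ ≡ e₁ → c₂ ≡ e₂ → c₃ ≡ e₃ →
                  NotRainbow c₁ c₂ c₃ → NotRainbow e₁ e₂ e₃
NotRainbow-cong refl refl refl nr = nr

NotRainbow-map : ∀ (h : ℕ → ℕ) {c₁ c₂ c₃} → NotRainbow c₁ c₂ c₃ → NotRainbow (h c₁) (h c₂) (h c₃)
NotRainbow-map h (inj₁ eq)        = inj₁ (cong h eq)
NotRainbow-map h (inj₂ (inj₁ eq)) = inj₂ (inj₁ (cong h eq))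
NotRainbow-map h (inj₂ (inj₂ eq)) = inj₂ (inj₂ (cong h eq))

RainbowFree : ℕ → (ℕ → ℕ) → Set
RainbowFree n f = ∀ a d → a + d + d < n → NotRainbow (f a) (f (a + d)) (f (a + d + d))

HasColours : ℕ → (ℕ → ℕ) → ℕ → Set
HasColours n f k = Σ (Fin k → ℕ) λ p → (∀ i → p i < n) × (∀ i j → f (p i) ≡ f (p j) → i ≡ j)

rainbowFree-at : ∀ {n f} → RainbowFree n f → ∀ x y z d → y ≡ x + d → z ≡ y + d → z < n →
                 NotRainbow (f x) (f y) (f z)
rainbowFree-at rf x _ _ d refl refl z<n = rf x d z<n

rainbowFree-≤ : ∀ {m n f} → m ≤ n → RainbowFree n f → RainbowFree m f
rainbowFree-≤ m≤n rf a d bound = rf a d (<-≤-trans bound m≤n)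

rainbowFree-shift : ∀ {n f} → RainbowFree (suc n) f → RainbowFree n (f ∘ suc)
rainbowFree-shift rf a d bound = rf (suc a) d (s≤s bound)

transport-colours : ∀ {n m k} {f g : ℕ → ℕ} (ψ : ℕ → ℕ) →
                    (∀ x → x < n → ψ x < m × g (ψ x) ≡ f x) → HasColours n f k → HasColours m g k
transport-colours ψ ψ-ok (p , p<n , inj) =
  ψ ∘ p , (λ i → proj₁ (ψ-ok _ (p<n i))) ,
  λ i j eq → inj i j (trans (sym (proj₂ (ψ-ok _ (p<n i)))) (trans eq (proj₂ (ψ-ok _ (p<n j)))))

fewer-colours : ∀ {n f k l} → l ≤ k → HasColours n f k → HasColours n f l
fewer-colours l≤k (p , p<n , inj) =
  (λ i → p (inject≤ i l≤k)) , (λ i → p<n _) ,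
  λ i j eq → FinP.inject≤-injective l≤k l≤k i j (inj _ _ eq)

covered-colours : ∀ {n f k m} (palette : Fin m → ℕ) →
                  (∀ x → x < n → ∃ λ t → f x ≡ palette t) → HasColours n f k → k ≤ m
covered-colours palette cover (p , p<n , inj) = FinP.injective⇒≤ λ {i} {j} eq →
  inj i j (trans (proj₂ (cover _ (p<n i))) (trans (cong palette eq) (sym (proj₂ (cover _ (p<n j))))))

data Parity : ℕ → Set where
  even : ∀ t → Parity (t + t)
  odd  : ∀ t → Parity (suc (t + t))

parity : ∀ k → Parity k
parity zero = even 0
parity (suc k) with parity k
... | even t = odd t
... | odd t  = subst Parity (cong suc (+-suc t t)) (even (suc t))

Class : ℕ → ℕ → Set
Class b x = ∃ λ m → x ≡ b + (m + m)

oddGap-parity : ∀ y t → (Class 0 y × Class 1 (y + suc (t + t))) ⊎ (Class 1 y × Class 0 (y + suc (t + t)))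
oddGap-parity y t with parity y
... | even s = inj₁ ((s , refl) , (s + t , even+odd s t))
  where
  even+odd : ∀ s t → s + s + suc (t + t) ≡ suc (s + t + (s + t))
  even+odd = solve-∀
... | odd s = inj₂ ((s , refl) , (suc (s + t) , odd+odd s t))
  where
  odd+odd : ∀ s t → suc (s + s) + suc (t + t) ≡ suc (s + t) + suc (s + t)
  odd+odd = solve-∀

oddGap-meets-even : ∀ y t → Class 0 y ⊎ Class 0 (y + suc (t + t))
oddGap-meets-even y t = [ inj₁ ∘ proj₁ , inj₂ ∘ proj₂ ]′ (oddGap-parity y t)

oddGap-meets-odd : ∀ y t → Class 1 y ⊎ Class 1 (y + suc (t + t))
oddGap-meets-odd y t = [ inj₂ ∘ proj₂ , inj₁ ∘ proj₁ ]′ (oddGap-parity y t)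

-- In a rainbow-free colouring, a u-point x followed by a v-point x + k (u ≢ v)
-- yields a u-point followed by a v-point at odd distance: for an even gap the
-- midpoint is coloured u or v (else x, x + k/2, x + k is rainbow), and one of
-- the two half-gaps again joins a u-point to a v-point.
oddPair : ∀ {n f u v} → RainbowFree n f → u ≢ v → ∀ x k → x + k < n → f x ≡ u → f (x + k) ≡ v →
          ∃₂ λ y t → y + suc (t + t) < n × f y ≡ u × f (y + suc (t + t)) ≡ v
oddPair {n} {f} {u} {v} rf u≢v x k = descend x k (<-wellFounded k)
  where
  descend : ∀ x k → Acc _<_ k → x + k < n → f x ≡ u → f (x + k) ≡ v →
            ∃₂ λ y t → y + suc (t + t) < n × f y ≡ u × f (y + suc (t + t)) ≡ v
  descend x k (acc smaller) bound fx fx+k with parity k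
  ... | odd t = x , t , bound , fx , fx+k
  ... | even zero = ⊥-elim (u≢v (trans (sym fx) (trans (cong f (sym (+-identityʳ x))) fx+k)))
  ... | even t@(suc _) with rf x t (subst (_< n) (sym (+-assoc x t t)) bound)
  ...   | inj₁ fx≡mid = descend (x + t) t (smaller (m<m+n t (s≤s z≤n)))
                          (subst (_< n) (sym (+-assoc x t t)) bound)
                          (trans (sym fx≡mid) fx) (trans (cong f (+-assoc x t t)) fx+k)
  ...   | inj₂ (inj₁ mid≡end) = descend x t (smaller (m<m+n t (s≤s z≤n)))
                                  (≤-<-trans (+-monoʳ-≤ x (m≤m+n t t)) bound)
                                  fx (trans mid≡end (trans (cong f (+-assoc x t t)) fx+k))
  ...   | inj₂ (inj₂ fx≡end) = ⊥-elim (u≢v (trans (sym fx) (trans fx≡end (trans (cong f (+-assoc x t t)) fx+k))))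

-- Fix a rainbow-free f on [0,n) and a class b + 2ℕ whose points below n are
-- b + 2m for m < h, and which contains an endpoint of every odd gap.  Reading f
-- along the class gives a rainbow-free colouring g of [0,h) that keeps all
-- colours of f but at most one.
module Restriction {n : ℕ} {f : ℕ → ℕ} (rf : RainbowFree n f) (b h : ℕ)
  (toRange   : ∀ {m} → m < h → b + (m + m) < n)
  (fromRange : ∀ {m} → b + (m + m) < n → m < h)
  (meets     : ∀ y t → Class b y ⊎ Class b (y + suc (t + t))) where

  g : ℕ → ℕ
  g m = f (b + (m + m))

  -- A 3-AP with step d in the class is a 3-AP with step 2d in [0,n).
  rainbowFree : RainbowFree h g
  rainbowFree a d bound =
    rainbowFree-at rf (b + (a + a)) _ _ (d + d) (stretch b a d) (stretch b (a + d) d) (toRange bound)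
    where
    stretch : ∀ b a d → b + ((a + d) + (a + d)) ≡ b + (a + a) + (d + d)
    stretch = solve-∀

  Represented : ℕ → Set
  Represented c = ∃ λ (m : Fin h) → g (toℕ m) ≡ c

  represented? : ∀ c → Dec (Represented c)
  represented? c = FinP.any? λ m → g (toℕ m) ≟ c

  represented : ∀ y → y < n → Class b y → Represented (f y)
  represented _ y<n (m , refl) = fromℕ< m<h , cong g (FinP.toℕ-fromℕ< m<h)
    where
    m<h : m < h
    m<h = fromRange {m} y<n

  -- Two distinct colours cannot both be missing from the class: oddPair gives
  -- points of these colours at odd distance, and one of them lies in the class.
  notBothMissing-≤ : ∀ x z → x ≤ z → z < n → f x ≢ f z →
                     ¬ Represented (f x) → ¬ Represented (f z) → ⊥
  notBothMissing-≤ x z x≤z z<n fx≢fz ¬rx ¬rz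
    with oddPair rf fx≢fz x (z ∸ x) (subst (_< n) (sym (m+[n∸m]≡n x≤z)) z<n) refl (cong f (m+[n∸m]≡n x≤z))
  ... | y , t , bound , fy , fy′ with meets y t
  ...   | inj₁ y∈b  = ¬rx (subst Represented fy (represented y (≤-<-trans (m≤m+n y _) bound) y∈b))
  ...   | inj₂ y′∈b = ¬rz (subst Represented fy′ (represented _ bound y′∈b))

  notBothMissing : ∀ x z → x < n → z < n → f x ≢ f z →
                   ¬ Represented (f x) → ¬ Represented (f z) → ⊥
  notBothMissing x z x<n z<n fx≢fz ¬rx ¬rz with ≤-total x z
  ... | inj₁ x≤z = notBothMissing-≤ x z x≤z z<n fx≢fz ¬rx ¬rz
  ... | inj₂ z≤x = notBothMissing-≤ z x z≤x x<n (fx≢fz ∘ sym) ¬rz ¬rx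

  -- Hence k+1 colours of f leave k colours of g: drop the possibly missing one.
  restrictColours : ∀ {k} → HasColours n f (suc k) → HasColours h g k
  restrictColours {k} (p , p<n , inj) = p′ , (λ i → FinP.toℕ<n _) , inj′
    where
    spare : ∃ λ i₀ → ∀ i → i ≢ i₀ → Represented (f (p i))
    spare with FinP.all? (λ i → represented? (f (p i)))
    ... | yes all = zero , λ i _ → all i
    ... | no ¬all with FinP.¬∀⟶∃¬ (suc k) _ (λ i → represented? (f (p i))) ¬all
    ...   | i₀ , ¬r₀ = i₀ , λ i i≢i₀ → decidable-stable (represented? _) λ ¬r →
              notBothMissing (p i) (p i₀) (p<n i) (p<n i₀) (λ eq → i≢i₀ (inj i i₀ eq)) ¬r ¬r₀

    rep : ∀ i → Represented (f (p (punchIn (proj₁ spare) i)))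
    rep i = proj₂ spare (punchIn (proj₁ spare) i) (FinP.punchInᵢ≢i (proj₁ spare) i)

    p′ : Fin k → ℕ
    p′ i = toℕ (proj₁ (rep i))

    inj′ : ∀ i j → g (p′ i) ≡ g (p′ j) → i ≡ j
    inj′ i j eq = FinP.punchIn-injective (proj₁ spare) i j
      (inj _ _ (trans (sym (proj₂ (rep i))) (trans eq (proj₂ (rep j)))))

odd<⇒<⌊/2⌋ : ∀ n {m} → suc (m + m) < n → m < ⌊ n /2⌋
odd<⇒<⌊/2⌋ 1 (s≤s ())
odd<⇒<⌊/2⌋ (suc (suc n)) {zero}  _ = s≤s z≤n
odd<⇒<⌊/2⌋ (suc (suc n)) {suc m} (s≤s (s≤s lt)) =
  s≤s (odd<⇒<⌊/2⌋ n (subst (_≤ n) (cong suc (+-suc m m)) lt))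

<⌊/2⌋⇒odd< : ∀ n {m} → m < ⌊ n /2⌋ → suc (m + m) < n
<⌊/2⌋⇒odd< (suc (suc n)) {zero}  _ = s≤s (s≤s z≤n)
<⌊/2⌋⇒odd< (suc (suc n)) {suc m} (s≤s lt) =
  s≤s (s≤s (subst (_≤ n) (cong suc (sym (+-suc m m))) (<⌊/2⌋⇒odd< n lt)))

restrictOdd : ∀ {n f k} → RainbowFree n f → HasColours n f (suc k) →
              RainbowFree ⌊ n /2⌋ (λ m → f (suc (m + m))) × HasColours ⌊ n /2⌋ (λ m → f (suc (m + m))) k
restrictOdd {n} rf cols = R.rainbowFree , R.restrictColours cols
  where
  module R = Restriction rf 1 ⌊ n /2⌋ (<⌊/2⌋⇒odd< n) (odd<⇒<⌊/2⌋ n) oddGap-meets-odd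

-- Restricting to the even points, ⌈n/2⌉ = ⌊(n+1)/2⌋ of them.
restrictEven : ∀ {n f k} → RainbowFree n f → HasColours n f (suc k) →
               RainbowFree ⌈ n /2⌉ (λ m → f (m + m)) × HasColours ⌈ n /2⌉ (λ m → f (m + m)) k
restrictEven {n} rf cols = R.rainbowFree , R.restrictColours cols
  where
  module R = Restriction rf 0 ⌈ n /2⌉ (≤-pred ∘ <⌊/2⌋⇒odd< (suc n)) (odd<⇒<⌊/2⌋ (suc n) ∘ s≤s)
                                    oddGap-meets-even

double-⌊n/2⌋≤n : ∀ n → 2 * ⌊ n /2⌋ ≤ n
double-⌊n/2⌋≤n zero = z≤n
double-⌊n/2⌋≤n (suc zero) = z≤n
double-⌊n/2⌋≤n (suc (suc n)) rewrite *-suc 2 ⌊ n /2⌋ = s≤s (s≤s (double-⌊n/2⌋≤n n))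

-- j + 1 colours on [0,n) need 2^j ≤ n: restricting to the odd points halves
-- [0,n) and loses at most one colour.
weakBound : ∀ j {n f} → RainbowFree n f → HasColours n f (suc j) → 2 ^ j ≤ n
weakBound zero    _ (p , p<n , _) = ≤-trans (s≤s z≤n) (p<n zero)
weakBound (suc j) {n} rf cols =
  let (rf′ , cols′) = restrictOdd rf cols
  in  ≤-trans (*-monoʳ-≤ 2 (weakBound j rf′ cols′)) (double-⌊n/2⌋≤n n)

dropLast : ∀ {n f k x} → x < n → f n ≡ f x → HasColours (suc n) f k → HasColours n f k
dropLast {n} {f} {x = x} x<n fn≡fx = transport-colours {g = f} ψ ψ-ok
  where
  ψ : ℕ → ℕ
  ψ y with y ≟ n
  ... | yes _ = x
  ... | no _  = y
  ψ-ok : ∀ y → y < suc n → ψ y < n × f (ψ y) ≡ f y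
  ψ-ok y y<1+n with y ≟ n
  ... | yes refl = x<n , sym fn≡fx
  ... | no y≢n   = ≤∧≢⇒< (≤-pred y<1+n) y≢n , refl

dropFirst : ∀ {n f k x} → 0 < x → x < suc n → f 0 ≡ f x →
            HasColours (suc n) f k → HasColours n (f ∘ suc) k
dropFirst {n} {f} {x = suc x} _ (s≤s x<n) f0≡fx = transport-colours {g = f ∘ suc} ψ ψ-ok
  where
  ψ : ℕ → ℕ
  ψ zero    = x
  ψ (suc y) = y
  ψ-ok : ∀ y → y < suc n → ψ y < n × f (suc (ψ y)) ≡ f y
  ψ-ok zero    _         = x<n , sym f0≡fx
  ψ-ok (suc y) (s≤s y<n) = y<n , refl

OneOf : ℕ → ℕ → ℕ → Set
OneOf a w c = c ≡ a ⊎ c ≡ w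

twoValues : ∀ {a b c d} → NotRainbow a b c → NotRainbow d a b → NotRainbow a d c →
            ∃ λ w → OneOf a w b × OneOf a w c × OneOf a w d
twoValues {a} {b} {c} {d} abc dab adc with b ≟ a
... | no b≢a = b , inj₂ refl , c∈ abc , d∈ dab
  where
  c∈ : NotRainbow a b c → OneOf a b c
  c∈ (inj₁ a≡b)        = ⊥-elim (b≢a (sym a≡b))
  c∈ (inj₂ (inj₁ b≡c)) = inj₂ (sym b≡c)
  c∈ (inj₂ (inj₂ a≡c)) = inj₁ (sym a≡c)
  d∈ : NotRainbow d a b → OneOf a b d
  d∈ (inj₁ d≡a)        = inj₁ d≡a
  d∈ (inj₂ (inj₁ a≡b)) = ⊥-elim (b≢a (sym a≡b))
  d∈ (inj₂ (inj₂ d≡b)) = inj₂ d≡b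
... | yes b≡a with c ≟ a
...   | no c≢a = c , inj₁ b≡a , inj₂ refl , d∈ adc
  where
  d∈ : NotRainbow a d c → OneOf a c d
  d∈ (inj₁ a≡d)        = inj₁ (sym a≡d)
  d∈ (inj₂ (inj₁ d≡c)) = inj₂ d≡c
  d∈ (inj₂ (inj₂ a≡c)) = ⊥-elim (c≢a (sym a≡c))
...   | yes c≡a = d , inj₁ b≡a , inj₁ c≡a , inj₂ refl

-- A rainbow-free colouring of [0,16) with five colours is impossible.  By the
-- weak bound 15 points carry at most four colours, so the colours of 0 and 15
-- occur nowhere else.  The progressions (0, d, 2d) and (15-2d, 15-d, 15) then
-- force f d = f 2d and f (15-2d) = f (15-d), so every inner point has the
-- colour of 1, 3, 5 or 7, and these take at most two values: four colours.
module Sixteen {f : ℕ → ℕ} (rf : RainbowFree 16 f) (cols : HasColours 16 f 5) where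

  fifteen-impossible : ∀ {g} → RainbowFree 15 g → HasColours 15 g 5 → ⊥
  fifteen-impossible rf′ cols′ = nlit (weakBound 4 rf′ cols′)

  first-unique : ∀ x → 0 < x → x < 16 → f 0 ≢ f x
  first-unique x 0<x x<16 eq = fifteen-impossible (rainbowFree-shift rf) (dropFirst 0<x x<16 eq cols)

  last-unique : ∀ x → x < 15 → f 15 ≢ f x
  last-unique x x<15 eq = fifteen-impossible (rainbowFree-≤ (n≤1+n 15) rf) (dropLast x<15 eq cols)

  doubling : ∀ d → 0 < d → d + d < 16 → f d ≡ f (d + d)
  doubling d 0<d bound with rf 0 d bound
  ... | inj₁ eq        = ⊥-elim (first-unique d 0<d (≤-<-trans (m≤m+n d d) bound) eq)
  ... | inj₂ (inj₁ eq) = eq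
  ... | inj₂ (inj₂ eq) = ⊥-elim (first-unique (d + d) (≤-trans 0<d (m≤m+n d d)) bound eq)

  halving : ∀ a d → a + d + d ≡ 15 → 0 < d → f a ≡ f (a + d)
  halving a d end 0<d with rf a d (subst (_< 16) (sym end) lit)
  ... | inj₁ eq        = eq
  ... | inj₂ (inj₁ eq) = ⊥-elim (last-unique (a + d) a+d<15 (sym (trans eq (cong f end))))
    where
    a+d<15 : a + d < 15
    a+d<15 = subst (a + d <_) end (m<m+n (a + d) 0<d)
  ... | inj₂ (inj₂ eq) = ⊥-elim (last-unique a a<15 (sym (trans eq (cong f end))))
    where
    a<15 : a < 15
    a<15 = ≤-<-trans (m≤m+n a d) (subst (a + d <_) end (m<m+n (a + d) 0<d))

  f2 : f 2 ≡ f 1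
  f2 = sym (doubling 1 lit lit)
  f4 : f 4 ≡ f 1
  f4 = trans (sym (doubling 2 lit lit)) f2
  f8 : f 8 ≡ f 1
  f8 = trans (sym (doubling 4 lit lit)) f4
  f6 : f 6 ≡ f 3
  f6 = sym (doubling 3 lit lit)
  f12 : f 12 ≡ f 3
  f12 = trans (sym (doubling 6 lit lit)) f6
  f9 : f 9 ≡ f 3
  f9 = trans (halving 9 3 refl lit) f12
  f10 : f 10 ≡ f 5
  f10 = sym (doubling 5 lit lit)
  f14 : f 14 ≡ f 7
  f14 = sym (doubling 7 lit lit)
  f13 : f 13 ≡ f 7
  f13 = trans (halving 13 1 refl lit) f14
  f11 : f 11 ≡ f 7
  f11 = trans (halving 11 2 refl lit) f13

  inner : ∃ λ w → OneOf (f 1) w (f 3) × OneOf (f 1) w (f 5) × OneOf (f 1) w (f 7)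
  inner = twoValues (rf 1 2 lit)
                    (NotRainbow-cong refl f8 f9 (rf 7 1 lit))
                    (NotRainbow-cong f4 refl f10 (rf 4 3 lit))

  w : ℕ
  w = proj₁ inner

  palette : Fin 4 → ℕ
  palette zero                   = f 0
  palette (suc zero)             = f 15
  palette (suc (suc zero))       = f 1
  palette (suc (suc (suc zero))) = w

  Listed : ℕ → Set
  Listed x = ∃ λ t → f x ≡ palette t

  sameAs1 : ∀ {x} → f x ≡ f 1 → Listed x
  sameAs1 eq = suc (suc zero) , eq

  viaPair : ∀ {x y} → f x ≡ f y → OneOf (f 1) w (f y) → Listed x
  viaPair eq (inj₁ e) = suc (suc zero) , trans eq e
  viaPair eq (inj₂ e) = suc (suc (suc zero)) , trans eq e

  in3 : OneOf (f 1) w (f 3)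
  in3 = proj₁ (proj₂ inner)
  in5 : OneOf (f 1) w (f 5)
  in5 = proj₁ (proj₂ (proj₂ inner))
  in7 : OneOf (f 1) w (f 7)
  in7 = proj₂ (proj₂ (proj₂ inner))

  cover : All Listed (upTo 16)
  cover = (zero , refl) ∷ sameAs1 refl ∷ sameAs1 f2 ∷ viaPair refl in3 ∷ sameAs1 f4 ∷
          viaPair refl in5 ∷ viaPair f6 in3 ∷ viaPair refl in7 ∷ sameAs1 f8 ∷ viaPair f9 in3 ∷
          viaPair f10 in5 ∷ viaPair f11 in7 ∷ viaPair f12 in3 ∷ viaPair f13 in7 ∷ viaPair f14 in7 ∷
          (suc zero , refl) ∷ []

  impossible : ⊥
  impossible = nlit (covered-colours palette (λ x x<16 → lookupAll cover (∈-upTo⁺ x<16)) cols)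

pow2≤15⇒≤8 : ∀ k → 2 ^ k ≤ 15 → 2 ^ k ≤ 8
pow2≤15⇒≤8 k le with k ≤? 3
... | yes k≤3 = ^-monoʳ-≤ 2 k≤3
... | no k≰3  = ⊥-elim (nlit (≤-trans (^-monoʳ-≤ 2 (≰⇒> k≰3)) le))

double-<⌈n/2⌉ : ∀ n {x} → x < ⌈ n /2⌉ → 2 * x < n
double-<⌈n/2⌉ n {x} x<⌈n/2⌉ =
  ≤-pred (subst (_≤ suc n) (*-suc 2 x) (≤-trans (*-monoʳ-≤ 2 x<⌈n/2⌉) (double-⌊n/2⌋≤n (suc n))))

sixteenBound : ∀ j {f} → RainbowFree 16 f → HasColours 16 f (suc (suc j)) → 2 ^ suc j < 16
sixteenBound j {f} rf cols with suc j ≤? 3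
... | yes j+1≤3 = ≤-<-trans (^-monoʳ-≤ 2 j+1≤3) lit
... | no j+1≰3  = ⊥-elim (Sixteen.impossible rf (fewer-colours {f = f} (s≤s (≰⇒> j+1≰3)) cols))

-- For 9 ≤ n ≤ 15 the weak bound suffices, n = 16 is Sixteen, and for n ≥ 17
-- the even points form a colouring of ⌈n/2⌉ ≥ 9 points with one colour less.
strictBound : ∀ j {n f} → 9 ≤ n → RainbowFree n f → HasColours n f (suc j) → 2 ^ j < n
strictBound zero    9≤n _ _ = ≤-trans lit 9≤n
strictBound (suc j) {n} 9≤n rf cols with <-cmp n 16
... | tri< n<16 _ _ = ≤-trans (s≤s (pow2≤15⇒≤8 (suc j) (≤-trans (weakBound (suc j) rf cols) (≤-pred n<16)))) 9≤n
... | tri≈ _ refl _ = sixteenBound j rf cols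
... | tri> _ _ n>16 =
  let (rf′ , cols′) = restrictEven rf cols
  in  double-<⌈n/2⌉ n (strictBound j (⌈n/2⌉-mono n>16) rf′ cols′)

-- ν R x = min (R, v₃ x), where v₃ is the 3-adic valuation and v₃ 0 = ∞.
ν : ℕ → ℕ → ℕ
ν zero    _ = 0
ν (suc R) x with 3 ∣? x
... | yes (divides q _) = suc (ν R q)
... | no _              = 0

ν-indivisible : ∀ R {x} → ¬ 3 ∣ x → ν (suc R) x ≡ 0
ν-indivisible R {x} 3∤x with 3 ∣? x
... | yes 3∣x = ⊥-elim (3∤x 3∣x)
... | no _    = refl

ν-indivisible₂ : ∀ R {x y} → ¬ 3 ∣ x → ¬ 3 ∣ y → ν (suc R) x ≡ ν (suc R) y
ν-indivisible₂ R 3∤x 3∤y = trans (ν-indivisible R 3∤x) (sym (ν-indivisible R 3∤y))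

ν-triple : ∀ R q → ν (suc R) (q * 3) ≡ suc (ν R q)
ν-triple R q with 3 ∣? (q * 3)
... | yes (divides q′ eq) = cong (suc ∘ ν R) (*-cancelʳ-≡ q′ q 3 (sym eq))
... | no 3∤              = ⊥-elim (3∤ (n∣m*n q))

ν-bound : ∀ R x → ν R x ≤ R
ν-bound zero    _ = z≤n
ν-bound (suc R) x with 3 ∣? x
... | yes (divides q _) = s≤s (ν-bound R q)
... | no _              = z≤n

ν-zero : ∀ R → ν R 0 ≡ R
ν-zero zero    = refl
ν-zero (suc R) = trans (ν-triple R 0) (cong suc (ν-zero R))

ν-power : ∀ {R} j → j ≤ R → ν R (3 ^ j) ≡ j
ν-power {zero}  zero    _         = refl
ν-power {suc R} zero    _         = ν-indivisible R λ 3∣1 → contradiction (∣1⇒≡1 3∣1) λ ()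
ν-power {suc R} (suc j) (s≤s j≤R) = begin
  ν (suc R) (3 * 3 ^ j) ≡⟨ cong (ν (suc R)) (*-comm 3 (3 ^ j)) ⟩
  ν (suc R) (3 ^ j * 3) ≡⟨ ν-triple R (3 ^ j) ⟩
  suc (ν R (3 ^ j))     ≡⟨ cong suc (ν-power j j≤R) ⟩
  suc j                 ∎
  where open ≡-Reasoning

-- 3 ∣ 2d implies 3 ∣ d, as 2d + 2d = 3d + d.
3∣2d⇒3∣d : ∀ {d} → 3 ∣ d + d → 3 ∣ d
3∣2d⇒3∣d {d} 3∣2d = ∣m+n∣m⇒∣n (subst (3 ∣_) (four d) (∣m∣n⇒∣m+n 3∣2d 3∣2d)) (n∣m*n d)
  where
  four : ∀ d → (d + d) + (d + d) ≡ d * 3 + d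
  four = solve-∀

-- Case analysis on divisibility by 3, kept apart from the test inside ν.
by3 : ∀ x → 3 ∣ x ⊎ ¬ 3 ∣ x
by3 x with 3 ∣? x
... | yes 3∣x = inj₁ 3∣x
... | no 3∤x  = inj₂ 3∤x

-- If 3 divides a and d, the progression is
-- three times a progression, on which ν R is rainbow-free by induction.
-- Otherwise at least two of its terms are not divisible by 3 and get colour 0.
ν-rainbowFree : ∀ R a d → NotRainbow (ν R a) (ν R (a + d)) (ν R (a + d + d))
ν-rainbowFree zero    a d = inj₁ refl
ν-rainbowFree (suc R) a d with by3 a | by3 d
... | inj₁ (divides a′ refl) | inj₁ (divides d′ refl) =
  NotRainbow-cong (scaled refl) (scaled (distrib₂ a′ d′)) (scaled (distrib₃ a′ d′))
                  (NotRainbow-map suc (ν-rainbowFree R a′ d′))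
  where
  scaled : ∀ {x y} → x * 3 ≡ y → suc (ν R x) ≡ ν (suc R) y
  scaled {x} refl = sym (ν-triple R x)
  distrib₂ : ∀ a d → (a + d) * 3 ≡ a * 3 + d * 3
  distrib₂ = solve-∀
  distrib₃ : ∀ a d → (a + d + d) * 3 ≡ a * 3 + d * 3 + d * 3
  distrib₃ = solve-∀
... | inj₂ 3∤a | inj₁ 3∣d =
  inj₁ (ν-indivisible₂ R 3∤a λ 3∣a+d → 3∤a (∣m+n∣m⇒∣n (subst (3 ∣_) (+-comm a d) 3∣a+d) 3∣d))
... | inj₁ 3∣a | inj₂ 3∤d =
  inj₂ (inj₁ (ν-indivisible₂ R (λ 3∣a+d → 3∤d (∣m+n∣m⇒∣n 3∣a+d 3∣a))
                               (λ 3∣a+2d → 3∤d (3∣2d⇒3∣d (∣m+n∣m⇒∣n (subst (3 ∣_) (+-assoc a d d) 3∣a+2d) 3∣a)))))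
... | inj₂ 3∤a | inj₂ 3∤d with by3 (a + d)
...   | inj₁ 3∣a+d = inj₂ (inj₂ (ν-indivisible₂ R 3∤a λ 3∣a+2d → 3∤d (∣m+n∣m⇒∣n 3∣a+2d 3∣a+d)))
...   | inj₂ 3∤a+d  = inj₁ (ν-indivisible₂ R 3∤a 3∤a+d)

-- The colouring of ℕ induced by a colouring of Fin n (points ≥ n get colour 0).
extend : ∀ {n r} → (Fin n → Fin r) → ℕ → ℕ
extend {n} c x with x <? n
... | yes x<n = toℕ (c (fromℕ< x<n))
... | no _    = 0

extend-fromℕ< : ∀ {n r} (c : Fin n → Fin r) {x} (x<n : x < n) → extend c x ≡ toℕ (c (fromℕ< x<n))
extend-fromℕ< {n} c {x} x<n with x <? n
... | yes _   = refl
... | no x≮n = ⊥-elim (x≮n x<n)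

extend-toℕ : ∀ {n r} (c : Fin n → Fin r) i → extend c (toℕ i) ≡ toℕ (c i)
extend-toℕ c i = trans (extend-fromℕ< c (FinP.toℕ<n i)) (cong (toℕ ∘ c) (FinP.fromℕ<-toℕ i _))

exact-colours : ∀ {n r} (c : Fin n → Fin r) → Exact c → HasColours n (extend c) r
exact-colours {r = r} c exact = p , (λ j → FinP.toℕ<n _) , inj
  where
  p : Fin r → ℕ
  p j = toℕ (proj₁ (exact j))
  hit : ∀ j → extend c (p j) ≡ toℕ j
  hit j = trans (extend-toℕ c _) (cong toℕ (proj₂ (exact j)))
  inj : ∀ i j → extend c (p i) ≡ extend c (p j) → i ≡ j
  inj i j eq = FinP.toℕ-injective (trans (sym (hit i)) (trans eq (hit j)))

-- A rainbow 3-AP inside [0,n), with start and step in Fin n so that its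
-- existence is decidable.
RainbowIn : ℕ → (ℕ → ℕ) → Set
RainbowIn n f = ∃₂ λ (a d : Fin n) → toℕ a + toℕ d + toℕ d < n ×
                ¬ NotRainbow (f (toℕ a)) (f (toℕ a + toℕ d)) (f (toℕ a + toℕ d + toℕ d))

rainbowIn? : ∀ n f → Dec (RainbowIn n f)
rainbowIn? n f = FinP.any? λ a → FinP.any? λ d → (_ <? n) ×-dec ¬? (notRainbow? _ _ _)

noRainbow⇒rainbowFree : ∀ {n f} → ¬ RainbowIn n f → RainbowFree n f
noRainbow⇒rainbowFree {n} {f} none a d bound with notRainbow? (f a) (f (a + d)) (f (a + d + d))
... | yes nr  = nr
... | no ¬nr = ⊥-elim (none (fromℕ< a<n , fromℕ< d<n ,
                 subst₂ Rainbow (sym (FinP.toℕ-fromℕ< a<n)) (sym (FinP.toℕ-fromℕ< d<n)) (bound , ¬nr)))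
  where
  Rainbow : ℕ → ℕ → Set
  Rainbow a d = a + d + d < n × ¬ NotRainbow (f a) (f (a + d)) (f (a + d + d))
  a<n : a < n
  a<n = ≤-<-trans (≤-trans (m≤m+n a d) (m≤m+n (a + d) d)) bound
  d<n : d < n
  d<n = ≤-<-trans (m≤n+m d (a + d)) bound

-- Defs writes the last term of a 3-AP as a + 2 * d.
twice : ∀ a d → a + d + d ≡ a + 2 * d
twice = solve-∀

forcing : ∀ {n r} → (∀ f → RainbowFree n f → HasColours n f r → ⊥) → Forces3 n r
forcing {n} impossible c exact with rainbowIn? n (extend c)
... | no none = ⊥-elim (impossible (extend c) (noRainbow⇒rainbowFree none) (exact-colours c exact))
... | yes (a , d , bound , rainbow) =
  a , y , z , toℕ d , n≢0⇒n>0 d≢0 , FinP.toℕ-fromℕ< a+d<n ,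
  trans (FinP.toℕ-fromℕ< bound) (twice (toℕ a) (toℕ d)) ,
  (λ eq → rainbow (inj₁ (trans cx (trans (cong toℕ eq) (sym cy))))) ,
  (λ eq → rainbow (inj₂ (inj₁ (trans cy (trans (cong toℕ eq) (sym cz)))))) ,
  (λ eq → rainbow (inj₂ (inj₂ (trans cx (trans (cong toℕ eq) (sym cz))))))
  where
  a+d<n : toℕ a + toℕ d < n
  a+d<n = ≤-<-trans (m≤m+n _ (toℕ d)) bound
  y z : Fin n
  y = fromℕ< a+d<n
  z = fromℕ< bound
  cx : extend c (toℕ a) ≡ toℕ (c a)
  cx = extend-toℕ c a
  cy : extend c (toℕ a + toℕ d) ≡ toℕ (c y)
  cy = extend-fromℕ< c a+d<n
  cz : extend c (toℕ a + toℕ d + toℕ d) ≡ toℕ (c z)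
  cz = extend-fromℕ< c bound
  d≢0 : toℕ d ≢ 0
  d≢0 d≡0 = rainbow (inj₁ (cong (extend c) (sym (trans (cong (toℕ a +_) d≡0) (+-identityʳ (toℕ a))))))

avoiding : ∀ {n r} (f : ℕ → ℕ) → (∀ x → x < n → f x < r) → (∀ j → j < r → ∃ λ x → x < n × f x ≡ j) →
           RainbowFree n f → ¬ Forces3 n r
avoiding {n} {r} f f<r onto rf forces = noRainbow (forces c exact)
  where
  c : Fin n → Fin r
  c i = fromℕ< (f<r (toℕ i) (FinP.toℕ<n i))
  colour : ∀ i → toℕ (c i) ≡ f (toℕ i)
  colour i = FinP.toℕ-fromℕ< _
  same : ∀ i j → f (toℕ i) ≡ f (toℕ j) → c i ≡ c j
  same i j eq = FinP.toℕ-injective (trans (colour i) (trans eq (sym (colour j))))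
  exact : Exact c
  exact j =
    let (x , x<n , fx≡j) = onto (toℕ j) (FinP.toℕ<n j)
    in  fromℕ< x<n , FinP.toℕ-injective (trans (colour _) (trans (cong f (FinP.toℕ-fromℕ< x<n)) fx≡j))
  noRainbow : HasRainbow3AP c → ⊥
  noRainbow (x , y , z , d , _ , y≡ , z≡ , x≢y , y≢z , x≢z)
    with rainbowFree-at rf (toℕ x) (toℕ y) (toℕ z) d y≡
           (trans z≡ (trans (sym (twice _ d)) (cong (_+ d) (sym y≡)))) (FinP.toℕ<n z)
  ... | inj₁ eq        = x≢y (same x y eq)
  ... | inj₂ (inj₁ eq) = y≢z (same y z eq)
  ... | inj₂ (inj₂ eq) = x≢z (same x z eq)

threeAdic-avoids : ∀ {n L r} → 0 < n → (∀ m → m < L → 3 ^ m < n) → 1 ≤ r → r < L + 2 → ¬ Forces3 n r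
threeAdic-avoids {n} {L} {suc R} 0<n pow (s≤s z≤n) r<L+2 =
  avoiding (ν R) (λ x _ → s≤s (ν-bound R x)) onto (λ a d _ → ν-rainbowFree R a d)
  where
  R≤L : R ≤ L
  R≤L = ≤-pred (≤-pred (subst (suc (suc R) ≤_) (+-comm L 2) r<L+2))
  onto : ∀ j → j < suc R → ∃ λ x → x < n × ν R x ≡ j
  onto j j<1+R with m<1+n⇒m<n∨m≡n j<1+R
  ... | inj₁ j<R  = 3 ^ j , pow j (<-≤-trans j<R R≤L) , ν-power j (<⇒≤ j<R)
  ... | inj₂ refl = 0 , 0<n , ν-zero R

forces-strict : ∀ {n j} → 9 ≤ n → n ≤ 2 ^ j → Forces3 n (suc j)
forces-strict 9≤n n≤2^j = forcing λ f rf cols → <⇒≱ (strictBound _ 9≤n rf cols) n≤2^j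

forces-weak : ∀ {n j} → n < 2 ^ j → Forces3 n (suc j)
forces-weak n<2^j = forcing λ f rf cols → <⇒≱ n<2^j (weakBound _ rf cols)

colour8 : ℕ → ℕ
colour8 0 = 0
colour8 1 = 1
colour8 2 = 1
colour8 3 = 2
colour8 4 = 1
colour8 5 = 2
colour8 6 = 2
colour8 _ = 3

eight-avoids : ¬ Forces3 8 4
eight-avoids = avoiding colour8 bounded onto rainbowFree
  where
  bounded : ∀ x → x < 8 → colour8 x < 4
  bounded x x<8 = lookupAll (toWitness {a? = all? (λ x → colour8 x <? 4) (upTo 8)} tt) (∈-upTo⁺ x<8)
  onto : ∀ j → j < 4 → ∃ λ x → x < 8 × colour8 x ≡ j
  onto 0 _ = 0 , lit , refl
  onto 1 _ = 1 , lit , refl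
  onto 2 _ = 3 , lit , refl
  onto 3 _ = 7 , lit , refl
  onto (suc (suc (suc (suc j)))) j<4 = ⊥-elim (m+n≮m 4 j j<4)
  rainbowFree : RainbowFree 8 colour8
  rainbowFree = noRainbow⇒rainbowFree (toWitnessFalse {a? = rainbowIn? 8 colour8} tt)

aw-bounds : ∀ n → 9 ≤ n → ∀ l3 l2 r → CeilLog 3 n l3 → CeilLog 2 n l2 →
            IsAw3 n r → (l3 + 2 ≤ r) × (r ≤ l2 + 1)
aw-bounds n 9≤n l3 l2 r (_ , below3) (n≤2^l2 , _) (1≤r , forces-r , minimal) =
  ≮⇒≥ (λ r<l3+2 → threeAdic-avoids (≤-trans lit 9≤n) below3 1≤r r<l3+2 forces-r) ,
  ≮⇒≥ (λ l2+1<r → minimal (l2 + 1) (m≤n+m 1 l2) l2+1<r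
                     (subst (Forces3 n) (+-comm 1 l2) (forces-strict 9≤n n≤2^l2)))

small-log : ∀ {n L} → 3 ≤ n → n ≤ 7 → n ≤ 3 ^ L → n < 2 ^ suc L
small-log {L = zero}        3≤n _   n≤1 = ⊥-elim (nlit (≤-trans 3≤n n≤1))
small-log {L = suc zero}    _   _   n≤3 = s≤s n≤3
small-log {L = suc (suc L)} _   n≤7 _   = ≤-<-trans n≤7 (<-≤-trans lit (^-monoʳ-≤ 2 (m≤m+n 3 L)))

between3and7 : ∀ {n} → (n ≡ 3 ⊎ n ≡ 4 ⊎ n ≡ 5 ⊎ n ≡ 6 ⊎ n ≡ 7) → 3 ≤ n × n ≤ 7
between3and7 (inj₁ refl)                      = lit , lit
between3and7 (inj₂ (inj₁ refl))               = lit , lit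
between3and7 (inj₂ (inj₂ (inj₁ refl)))        = lit , lit
between3and7 (inj₂ (inj₂ (inj₂ (inj₁ refl)))) = lit , lit
between3and7 (inj₂ (inj₂ (inj₂ (inj₂ refl)))) = lit , lit

aw-small : ∀ n → (n ≡ 3 ⊎ n ≡ 4 ⊎ n ≡ 5 ⊎ n ≡ 6 ⊎ n ≡ 7) → ∀ l3 →
           CeilLog 3 n l3 → IsAw3 n (l3 + 2)
aw-small n n∈[3,7] l3 (n≤3^l3 , below3) =
  ≤-trans lit (m≤n+m 2 l3) ,
  subst (Forces3 n) (+-comm 2 l3) (forces-weak (small-log {L = l3} 3≤n n≤7 n≤3^l3)) ,
  λ r′ 1≤r′ r′<l3+2 → threeAdic-avoids (≤-trans lit 3≤n) below3 1≤r′ r′<l3+2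
  where
  3≤n : 3 ≤ n
  3≤n = proj₁ (between3and7 n∈[3,7])
  n≤7 : n ≤ 7
  n≤7 = proj₂ (between3and7 n∈[3,7])

-- aw([8],3) = 5: 16 > 8 points are needed for five colours, while 3^0, 3^1 < 8
-- give rainbow-free colourings with up to three colours and colour8 with four.
aw-eight : IsAw3 8 5
aw-eight = lit , forces-weak lit , minimal
  where
  below : ∀ m → m < 2 → 3 ^ m < 8
  below 0 _ = lit
  below 1 _ = lit
  below (suc (suc m)) m<2 = ⊥-elim (m+n≮m 2 m m<2)
  minimal : ∀ r′ → 1 ≤ r′ → r′ < 5 → ¬ Forces3 8 r′
  minimal r′ 1≤r′ r′<5 with m<1+n⇒m<n∨m≡n r′<5
  ... | inj₁ r′<4 = threeAdic-avoids {L = 2} lit below 1≤r′ r′<4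
  ... | inj₂ refl = eight-avoids

theorem1p1 : (∀ (n : ℕ) → 9 ≤ n → ∀ (l3 l2 r : ℕ) → CeilLog 3 n l3 → CeilLog 2 n l2 →
    IsAw3 n r → (l3 + 2 ≤ r) × (r ≤ l2 + 1))
    × (∀ (n : ℕ) → (n ≡ 3 ⊎ n ≡ 4 ⊎ n ≡ 5 ⊎ n ≡ 6 ⊎ n ≡ 7) → ∀ (l3 : ℕ) →
    CeilLog 3 n l3 → IsAw3 n (l3 + 2))
    × IsAw3 8 5
theorem1p1 = aw-bounds , aw-small , aw-eight
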